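{- Let $n\ge 4$ and let $\emptyset\neq J\subseteq[1,n-1]$ with $\mu=\min J$. Let $\mu\le a<b$ and $K=[\mu,a]\cup[b,n-1]$. Then $\overrightarrow{\delta}(J)\le_L\overrightarrow{\delta}(J\cap K)$.
   Context: Intervals are in $\mathbb Z$. For $J\subseteq\{1,\dots,n-1\}$, write $J\cup\{n\}=\{j_1<\dots<j_p<j_{p+1}=n\}$ and set $\overrightarrow{\delta}(J)=(j_2-j_1,\dots,j_{p+1}-j_p)$, a word in the alphabet $\{1,\dots,n-1\}$. $\le_L$ is the lexicographic (left to right) order on the set of all finite words (including the empty word) in the alphabet $\{1,\dots,n-1\}$. -}

module Defs where

open import Data.Nat using (ℕ; zero; suc; _∸_; _<_; _≤_)
open import Data.Bool using (Bool; true; false; if_then_else_)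
open import Data.List using (List; []; _∷_; _++_; filter)
open import Data.List using (upTo)
open import Data.Nat using (_≤?_; _<?_)
open import Data.Nat.Properties using (<-strictTotalOrder)
open import Relation.Binary.PropositionalEquality using (_≡_)
open import Relation.Nullary.Decidable using (⌊_⌋; _×-dec_)
open import Data.List.Relation.Binary.Lex.Strict using (Lex-≤)

Subset : Set
Subset = ℕ → Bool

⊆[1,n-1] : ℕ → Subset → Set
⊆[1,n-1] n J = ∀ i → J i ≡ true → (1 ≤ i) Data.Product.× (i < n)
  where import Data.Product

_∩_ : Subset → Subset → Subset
(J ∩ K) i = if J i then K i else false

-- the interval subset [x, y] of ℤ restricted to ℕ (intervals used here lie in ℕ)
interval : ℕ → ℕ → Subset
interval x y i = ⌊ x ≤? i ⌋ Data.Bool.∧ ⌊ i ≤? y ⌋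
  where import Data.Bool

_∪_ : Subset → Subset → Subset
(A ∪ B) i = A i Data.Bool.∨ B i
  where import Data.Bool

-- the elements of J ∩ [1, n-1] in increasing order, followed by n
elemsWithN : ℕ → Subset → List ℕ
elemsWithN n J = filter (λ i → J i Data.Bool.Properties.≟ true) (Data.List.map suc (upTo (n ∸ 1))) ++ (n ∷ [])
  where import Data.Bool.Properties
        import Data.List

diffs : List ℕ → List ℕ
diffs [] = []
diffs (x ∷ []) = []
diffs (x ∷ y ∷ ys) = (y ∸ x) ∷ diffs (y ∷ ys)

δ⃗ : ℕ → Subset → List ℕ
δ⃗ n J = diffs (elemsWithN n J)

-- lexicographic order (prefixes, in particular the empty word, are smaller)
_≤L_ : List ℕ → List ℕ → Set
_≤L_ = Lex-≤ _≡_ _<_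

{-# OPTIONS --safe #-}
-- Only μ ∈ K matters. Removing elements from an increasing list j₁ < … < j_p < n
-- can only merge consecutive gaps: up to the first removed element the two difference
-- words agree, and at that position the gap of the thinned list is strictly larger.
-- Since μ = j₁ lies in K, both words start from j₁, so δ⃗(J) is a prefix of δ⃗(J ∩ K)
-- or is smaller at the first removed element.
module Submission where

open import Defs
open import Data.Nat using (ℕ; _≤_; _<_; _∸_)
open import Data.Bool using (true)
open import Relation.Binary.PropositionalEquality using (_≡_)

open import Data.Nat using (zero; suc; s≤s; z≤n; _≤?_)
open import Data.Nat.Properties using (≤-refl; <-trans; ≤-<-trans; <⇒≤; <⇒≱; ∸-monoˡ-<)
open import Data.Bool using (Bool; false)
open import Data.Bool.Properties using (_≟_)
open import Data.List using (List; []; _∷_; _++_; [_]; filter; map; upTo; applyUpTo)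
open import Data.List.Properties using (map-upTo)
open import Data.List.Membership.Propositional using (_∈_)
open import Data.List.Membership.Propositional.Properties using (∈-filter⁺; ∈-applyUpTo⁺)
open import Data.List.Relation.Unary.All as All using (All; _∷_)
open import Data.List.Relation.Unary.All.Properties using (all-filter)
open import Data.List.Relation.Unary.Any using (here; there)
open import Data.List.Relation.Binary.Lex.Core using (base; this; next)
open import Data.Product using (_×_; _,_)
open import Data.Unit using (tt)
open import Relation.Nullary.Decidable using (dec-true; isYes≗does)
open import Relation.Nullary.Negation using (contradiction)
open import Relation.Binary.PropositionalEquality using (refl; trans; cong)

select : (ℕ → Bool) → List ℕ → List ℕ
select K = filter (λ i → K i ≟ true)

select-∩ : ∀ J K xs → select (J ∩ K) xs ≡ select K (select J xs)
select-∩ J K [] = refl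
select-∩ J K (x ∷ xs) with J x
... | false = select-∩ J K xs
... | true with K x
...   | true = cong (x ∷_) (select-∩ J K xs)
...   | false = select-∩ J K xs

interval-true : ∀ {x y i} → x ≤ i → i ≤ y → interval x y i ≡ true
interval-true {x} {y} {i} x≤i i≤y
  rewrite trans (isYes≗does (x ≤? i)) (dec-true (x ≤? i) x≤i)
        | trans (isYes≗does (i ≤? y)) (dec-true (i ≤? y) i≤y) = refl

Ascending : ℕ → List ℕ → ℕ → Set
Ascending x [] n = x < n
Ascending x (z ∷ zs) n = x < z × Ascending z zs n

ascending-lower : ∀ {x y zs n} → x < y → Ascending y zs n → Ascending x zs n
ascending-lower {zs = []} x<y y<n = <-trans x<y y<n
ascending-lower {zs = z ∷ zs} x<y (y<z , z…n) = <-trans x<y y<z , z…n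

ascending-select : ∀ K {x} zs {n} → Ascending x zs n → Ascending x (select K zs) n
ascending-select K [] x<n = x<n
ascending-select K (z ∷ zs) (x<z , z…n) with K z
... | true = x<z , ascending-select K zs z…n
... | false = ascending-select K zs (ascending-lower x<z z…n)

ascending-applyUpTo : ∀ (f : ℕ → ℕ) m {x} → x < f 0 → (∀ i → f i < f (suc i)) →
                      Ascending x (applyUpTo f m) (f m)
ascending-applyUpTo f zero x<f0 f-mono = x<f0
ascending-applyUpTo f (suc m) x<f0 f-mono =
  x<f0 , ascending-applyUpTo (λ i → f (suc i)) m (f-mono 0) (λ i → f-mono (suc i))

ascending-lower-< : ∀ {x zs n μ} → Ascending x zs n → μ ∈ zs → x < μ
ascending-lower-< (x<z , _) (here refl) = x<z
ascending-lower-< (x<z , z…n) (there μ∈zs) = <-trans x<z (ascending-lower-< z…n μ∈zs)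

-- z is the first dropped element after x and y the last dropped one seen so far.
first-gap-grows : ∀ K {x z y} ws {n t} → x ≤ z → z ≤ y → Ascending y ws n →
                  ((z ∸ x) ∷ t) ≤L diffs (x ∷ select K ws ++ [ n ])
first-gap-grows K [] x≤z z≤y y<n = this (∸-monoˡ-< (≤-<-trans z≤y y<n) x≤z)
first-gap-grows K (w ∷ ws) x≤z z≤y (y<w , w…n) with K w
... | true = this (∸-monoˡ-< (≤-<-trans z≤y y<w) x≤z)
... | false = first-gap-grows K ws x≤z (<⇒≤ (≤-<-trans z≤y y<w)) w…n

diffs-select-≤L : ∀ K {x} zs {n} → Ascending x zs n →
                  diffs (x ∷ zs ++ [ n ]) ≤L diffs (x ∷ select K zs ++ [ n ])
diffs-select-≤L K [] x<n = next refl (base tt)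
diffs-select-≤L K (z ∷ zs) (x<z , z…n) with K z
... | true = next refl (diffs-select-≤L K zs z…n)
... | false = first-gap-grows K zs (<⇒≤ x<z) ≤-refl z…n

diffs-select-min-≤L : ∀ K {x} ys {n μ} → Ascending x ys n → μ ∈ ys → All (μ ≤_) ys → K μ ≡ true →
                      diffs (ys ++ [ n ]) ≤L diffs (select K ys ++ [ n ])
diffs-select-min-≤L K (μ ∷ zs) (_ , μ…n) (here refl) _ Kμ rewrite Kμ = diffs-select-≤L K zs μ…n
diffs-select-min-≤L K (h ∷ zs) (_ , h…n) (there μ∈zs) (μ≤h ∷ _) _ =
  contradiction μ≤h (<⇒≱ (ascending-lower-< h…n μ∈zs))

lemma4p18 : (n : ℕ) → 4 ≤ n → (J : Subset) → ⊆[1,n-1] n J →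
    (μ : ℕ) → J μ ≡ true → (∀ j → J j ≡ true → μ ≤ j) →
    (a b : ℕ) → μ ≤ a → a < b →
    δ⃗ n J ≤L δ⃗ n (J ∩ (interval μ a ∪ interval b (n ∸ 1)))
lemma4p18 (suc m) _ J J⊆ μ Jμ μ-min a b μ≤a _
  rewrite select-∩ J (interval μ a ∪ interval b m) (map suc (upTo m))
        | map-upTo suc m =
  diffs-select-min-≤L K (select J range) ascending μ∈J (All.map (μ-min _) (all-filter _ range)) Kμ
  where
    K = interval μ a ∪ interval b m
    range = applyUpTo suc m

    ascending : Ascending 0 (select J range) (suc m)
    ascending = ascending-select J range (ascending-applyUpTo suc m (s≤s z≤n) (λ _ → ≤-refl))

    μ∈J : μ ∈ select J range
    μ∈J with J⊆ μ Jμ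
    ... | s≤s z≤n , s≤s μ<m = ∈-filter⁺ _ (∈-applyUpTo⁺ suc μ<m) Jμ

    Kμ : K μ ≡ true
    Kμ rewrite interval-true {μ} {a} ≤-refl μ≤a = refl
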